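{- The system $\mathbf{MI_{\Box}}$ is complete with respect to $\Box$-models and with respect to descriptive $\Box$-models: if a formula $\phi$ holds at every state of every $\Box$-model (respectively, of every descriptive $\Box$-model), then $\mathbf{MI_{\Box}}\vdash\phi$.
   Context: Formulas: $\phi ::= \top\mid p\mid\phi\wedge\phi\mid\phi\to\phi\mid\Box\phi$. $\mathbf{MI_{\Box}}$ is derived by modus ponens from substitution instances of (H1) $p\to(q\to p)$, (H2) $(p\to(q\to r))\to((p\to q)\to(p\to r))$, (H3) $(p\wedge q)\to p$, (H4) $(p\wedge q)\to q$, (H5) $p\to(q\to(p\wedge q))$, (H6) $\top$, $\Box(p\wedge q)\leftrightarrow(\Box p\wedge\Box q)$, $\Box\top\leftrightarrow\top$, and closed under the rule: from $p\leftrightarrow q$ infer $\Box p\leftrightarrow\Box q$ ($\leftrightarrow$ abbreviates the conjunction of both implications). An I-frame is an implicative meet-semilattice with top viewed as a poset $(X,\leq)$. A $\Box$-frame is $(X,\leq,R)$ with $(X,\leq)$ an I-frame and (B1) $\top Rx$ iff $x=\top$, and $xR\top$ for all $x$; (B2) $xRy\leq z\Rightarrow xRz$; (B3) $xRy,x'Ry'\Rightarrow(x\wedge x')R(y\wedge y')$; (B4) $(x\wedge x')Rz\Rightarrow\exists y,y'$, $xRy$, $x'Ry'$, $y\wedge y'=z$. A $\Box$-model adds a valuation assigning a filter (non-empty up-closed set closed under finite meets) to each letter. Satisfaction: $\top$ always; $x\Vdash p$ iff $x\in V(p)$; $\wedge$ pointwise; $x\Vdash\phi\to\psi$ iff all $y\geq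 x$ with $y\Vdash\phi$ satisfy $\psi$; $x\Vdash\Box\phi$ iff all $R$-successors satisfy $\phi$. A descriptive $\Box$-frame is $(X,\leq,R,A)$ with $(X,\leq,R)$ a $\Box$-frame and $A$ a set of filters closed under $\cap$ and $a\Rightarrow b=\{x\mid\forall y\geq x,\ y\in a\Rightarrow y\in b\}$, differentiated (if $x\not\leq y$ some $a\in A$ contains $x$ not $y$), compact (covers by members of $A$ and complements have finite subcovers), closed under $p\mapsto\{x\mid R[x]\subseteq p\}$, and with $R[x]=\bigcap\{a\in A\mid R[x]\subseteq a\}$ for all $x$, where $R[x]=\{y\mid xRy\}$. A descriptive $\Box$-model is a descriptive $\Box$-frame with a valuation taking values in $A$. -}

module Defs where

open import Level using (Level; _⊔_; suc)
open import Agda.Primitive using (Setω)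
open import Data.Nat using (ℕ)
open import Data.Product using (Σ; Σ-syntax; ∃; _×_; _,_)
open import Data.Sum using (_⊎_)
open import Data.List using (List)
open import Data.List.Relation.Unary.All using (All)
open import Data.List.Relation.Unary.Any using (Any)
open import Relation.Nullary using (¬_)
open import Relation.Unary using (Pred; _∈_; _∉_; _⊆_; _∩_)
open import Relation.Binary using (Rel)
open import Relation.Binary.Lattice.Bundles using (BoundedMeetSemilattice)
open import Relation.Binary.Lattice.Definitions using (Exponential)

infixr 6 _∧'_
infixr 5 _⇒'_ _⇔'_

data Form : Set where
  ⊤'   : Form
  var  : ℕ → Form
  _∧'_ : Form → Form → Form
  _⇒'_ : Form → Form → Form
  □'   : Form → Form

_⇔'_ : Form → Form → Form
φ ⇔' ψ = (φ ⇒' ψ) ∧' (ψ ⇒' φ)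

-- The system MI_□ (axioms taken as all substitution instances, i.e.
-- schemata over arbitrary formulas; closed under MP and the □-rule).

data MI□⊢_ : Form → Set where
  H1  : ∀ p q → MI□⊢ (p ⇒' (q ⇒' p))
  H2  : ∀ p q r → MI□⊢ ((p ⇒' (q ⇒' r)) ⇒' ((p ⇒' q) ⇒' (p ⇒' r)))
  H3  : ∀ p q → MI□⊢ ((p ∧' q) ⇒' p)
  H4  : ∀ p q → MI□⊢ ((p ∧' q) ⇒' q)
  H5  : ∀ p q → MI□⊢ (p ⇒' (q ⇒' (p ∧' q)))
  H6  : MI□⊢ ⊤'
  B∧  : ∀ p q → MI□⊢ (□' (p ∧' q) ⇔' (□' p ∧' □' q))
  B⊤  : MI□⊢ (□' ⊤' ⇔' ⊤')
  MP  : ∀ {p q} → MI□⊢ p → MI□⊢ (p ⇒' q) → MI□⊢ q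
  RE□ : ∀ {p q} → MI□⊢ (p ⇔' q) → MI□⊢ (□' p ⇔' □' q)

-- I-frames: implicative meet-semilattices with top, viewed as posets.
-- (Posets are stdlib setoid-based posets: equality is _≈_.)
-- All carriers, relations and subsets live in a single universe level ℓ.

record IFrame (ℓ : Level) : Set (suc ℓ) where
  field
    bms         : BoundedMeetSemilattice ℓ ℓ ℓ
  open BoundedMeetSemilattice bms public
  infixr 5 _⇨_
  field
    _⇨_         : Carrier → Carrier → Carrier
    exponential : Exponential _≤_ _∧_ _⇨_

record BoxFrame (ℓ : Level) : Set (suc ℓ) where
  field
    iframe : IFrame ℓ
  open IFrame iframe public
  field
    R       : Rel Carrier ℓ
    -- R respects the underlying equality (automatic when _≈_ is ≡)
    R-resp  : ∀ {x x' y} → x ≈ x' → R x y → R x' y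
    B1a     : ∀ x → R ⊤ x → x ≈ ⊤
    B1b     : ∀ x → x ≈ ⊤ → R ⊤ x
    B1c     : ∀ x → R x ⊤
    B2      : ∀ {x y z} → R x y → y ≤ z → R x z
    B3      : ∀ {x x' y y'} → R x y → R x' y' → R (x ∧ x') (y ∧ y')
    B4      : ∀ {x x' z} → R (x ∧ x') z →
              Σ[ y ∈ Carrier ] Σ[ y' ∈ Carrier ] (R x y × R x' y' × (y ∧ y') ≈ z)

  R[_] : Carrier → Pred Carrier ℓ
  R[ x ] = R x

record IsFilter {ℓ : Level} (F : IFrame ℓ) (a : Pred (IFrame.Carrier F) ℓ) : Set ℓ where
  open IFrame F
  field
    nonempty : Σ[ x ∈ Carrier ] (x ∈ a)
    upclosed : ∀ {x y} → x ∈ a → x ≤ y → y ∈ a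
    meet     : ∀ {x y} → x ∈ a → y ∈ a → (x ∧ y) ∈ a

record BoxModel (ℓ : Level) : Set (suc ℓ) where
  field
    frame : BoxFrame ℓ
  open BoxFrame frame public
  field
    V        : ℕ → Pred Carrier ℓ
    V-filter : ∀ p → IsFilter iframe (V p)

module _ {ℓ : Level} (F : BoxFrame ℓ) (V : ℕ → Pred (BoxFrame.Carrier F) ℓ) where
  open BoxFrame F
  open import Data.Unit.Polymorphic using () renaming (⊤ to Unit)

  sat : Carrier → Form → Set ℓ
  sat x ⊤'       = Unit
  sat x (var p)  = x ∈ V p
  sat x (φ ∧' ψ) = sat x φ × sat x ψ
  sat x (φ ⇒' ψ) = ∀ y → x ≤ y → sat y φ → sat y ψ
  sat x (□' φ)   = ∀ y → R x y → sat y φ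

_,_⊩_ : ∀ {ℓ} (M : BoxModel ℓ) → BoxModel.Carrier M → Form → Set ℓ
M , x ⊩ φ = sat (BoxModel.frame M) (BoxModel.V M) x φ

record DescFrame (ℓ : Level) : Set (suc ℓ) where
  field
    frame : BoxFrame ℓ
  open BoxFrame frame public

  _⇛_ : Pred Carrier ℓ → Pred Carrier ℓ → Pred Carrier ℓ
  (a ⇛ b) x = ∀ y → x ≤ y → y ∈ a → y ∈ b

  ⟦□⟧ : Pred Carrier ℓ → Pred Carrier ℓ
  ⟦□⟧ a x = R[ x ] ⊆ a

  field
    A          : Pred (Pred Carrier ℓ) ℓ
    A-filters  : ∀ a → a ∈ A → IsFilter iframe a
    A-∩        : ∀ a b → a ∈ A → b ∈ A → (a ∩ b) ∈ A
    A-⇒        : ∀ a b → a ∈ A → b ∈ A → (a ⇛ b) ∈ A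
    A-□        : ∀ a → a ∈ A → ⟦□⟧ a ∈ A
    differentiated : ∀ x y → ¬ (x ≤ y) → Σ[ a ∈ Pred Carrier ℓ ] (a ∈ A × x ∈ a × y ∉ a)
    compact : ∀ (S T : Pred (Pred Carrier ℓ) ℓ) → S ⊆ A → T ⊆ A →
              (∀ x → (Σ[ a ∈ Pred Carrier ℓ ] (a ∈ S × x ∈ a)) ⊎ (Σ[ b ∈ Pred Carrier ℓ ] (b ∈ T × x ∉ b))) →
              Σ[ as ∈ List (Pred Carrier ℓ) ] Σ[ bs ∈ List (Pred Carrier ℓ) ]
                (All (_∈ S) as × All (_∈ T) bs ×
                 (∀ x → Any (x ∈_) as ⊎ Any (x ∉_) bs))
    -- R[x] = ⋂ { a ∈ A | R[x] ⊆ a }  (both inclusions)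
    R⊆⋂ : ∀ x y → y ∈ R[ x ] → (∀ a → a ∈ A → R[ x ] ⊆ a → y ∈ a)
    ⋂⊆R : ∀ x y → (∀ a → a ∈ A → R[ x ] ⊆ a → y ∈ a) → y ∈ R[ x ]

record DescModel (ℓ : Level) : Set (suc ℓ) where
  field
    dframe : DescFrame ℓ
  open DescFrame dframe public
  field
    V   : ℕ → Pred Carrier ℓ
    V-A : ∀ p → V p ∈ DescFrame.A dframe

  model : BoxModel ℓ
  model = record { frame = frame ; V = V ; V-filter = λ p → A-filters (V p) (V-A p) }

ValidBox : Form → Setω
ValidBox φ = ∀ {ℓ} (M : BoxModel ℓ) (x : BoxModel.Carrier M) → M , x ⊩ φ

ValidDesc : Form → Setω
ValidDesc φ = ∀ {ℓ} (M : DescModel ℓ) (x : DescModel.Carrier M) → DescModel.model M , x ⊩ φ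

record _×ω_ (P Q : Setω) : Setω where
  constructor _,ω_
  field
    fst : P
    snd : Q

-- The counter-model is finite and built from φ alone. Its worlds are modal contexts
-- Γ₀ ⇒ □ (Γ₁ ⇒ □ (… ⇒ [ ])) with premises among the antecedents of φ and at most depth φ
-- boxes; a world proves χ when χ plugged into it is a theorem. A point is a finite list of
-- worlds, read as the up-set it generates: concatenation is the meet, the uncovered part of Q
-- is P ⇨ Q, and P R Q when Q lies above the worlds of P with one more box at the hole. With p
-- true at P iff every world of P proves p, a truth lemma shows that a point whose worlds have
-- room for χ satisfies χ iff all its worlds prove χ; the point consisting of the empty context
-- therefore refutes every non-theorem φ. Up to ≈ there are finitely many points, so with all
-- filters as admissible sets the model is descriptive and lies in both classes.

module Submission where

open import Defs
open import Level using (0ℓ)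
open import Function using (_∘_; id; _⇔_; mk⇔; Equivalence)
open Equivalence using (to; from)
open import Data.Nat as ℕ using (ℕ; zero; suc; _⊔_; z≤n; s≤s)
import Data.Nat.Properties as ℕₚ
open import Data.Bool as Bool using (Bool; true; false)
import Data.Bool.Properties as Boolₚ
open import Data.Vec using (Vec; []; _∷_; replicate)
open import Data.Vec.Relation.Binary.Pointwise.Inductive as Pointwise using (Pointwise; []; _∷_)
open import Data.List using (List; []; _∷_; _++_; map; filter; length; cartesianProductWith)
open import Data.List.Properties using (map-++)
open import Data.List.Relation.Unary.All as All using (All; []; _∷_)
import Data.List.Relation.Unary.All.Properties as Allₚ
open import Data.List.Relation.Unary.Any as Any using (Any; here; there; any?)
import Data.List.Relation.Unary.Any.Properties as Anyₚ
open import Data.List.Membership.Propositional using (_∈_; find; lose)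
open import Data.List.Membership.Propositional.Properties
  using (∈-++⁺ˡ; ∈-++⁺ʳ; ∈-++⁻; ∈-map⁺; ∈-map⁻; ∈-filter⁺; ∈-filter⁻; ∈-cartesianProductWith⁺)
open import Data.List.Relation.Binary.Subset.Propositional using (_⊆_)
open import Data.Product using (Σ-syntax; _×_; _,_; proj₁; proj₂; uncurry)
open import Data.Sum as Sum using (_⊎_; inj₁; inj₂)
open import Data.Empty using (⊥-elim)
open import Relation.Nullary using (¬_; Dec; yes; no; ¬?; does)
open import Relation.Nullary.Decidable using (map′; _×-dec_)
open import Relation.Unary using (Pred; Decidable)
open import Relation.Binary.Lattice.Bundles using (BoundedMeetSemilattice)
open import Relation.Binary.PropositionalEquality using (_≡_; refl; sym; subst; cong)

infix 3 _⊢_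

data _⊢_ (Γ : List Form) : Form → Set where
  hyp : ∀ {a} → a ∈ Γ → Γ ⊢ a
  thm : ∀ {a} → MI□⊢ a → Γ ⊢ a
  app : ∀ {a b} → Γ ⊢ a ⇒' b → Γ ⊢ a → Γ ⊢ b

lam : ∀ {Γ a b} → a ∷ Γ ⊢ b → Γ ⊢ a ⇒' b
lam {a = a} (hyp (here refl)) = thm (MP (H1 a a) (MP (H1 a (a ⇒' a)) (H2 a (a ⇒' a) a)))
lam {a = a} (hyp (there m))   = app (thm (H1 _ a)) (hyp m)
lam {a = a} (thm p)           = thm (MP p (H1 _ a))
lam {a = a} (app {c} {d} f x) = app (app (thm (H2 a c d)) (lam f)) (lam x)

closed : ∀ {a} → [] ⊢ a → MI□⊢ a
closed (thm p)   = p
closed (app f x) = MP (closed x) (closed f)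

#0 : ∀ {Γ a} → a ∷ Γ ⊢ a
#0 = hyp (here refl)

#1 : ∀ {Γ a b} → b ∷ a ∷ Γ ⊢ a
#1 = hyp (there (here refl))

#2 : ∀ {Γ a b c} → c ∷ b ∷ a ∷ Γ ⊢ a
#2 = hyp (there (there (here refl)))

∧-intro : ∀ {Γ a b} → Γ ⊢ a → Γ ⊢ b → Γ ⊢ a ∧' b
∧-intro x y = app (app (thm (H5 _ _)) x) y

∧-elimˡ : ∀ {Γ a b} → Γ ⊢ a ∧' b → Γ ⊢ a
∧-elimˡ = app (thm (H3 _ _))

∧-elimʳ : ∀ {Γ a b} → Γ ⊢ a ∧' b → Γ ⊢ b
∧-elimʳ = app (thm (H4 _ _))

⇒-refl : ∀ {a} → MI□⊢ (a ⇒' a)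
⇒-refl = closed (lam #0)

⇒-trans : ∀ {a b c} → MI□⊢ (a ⇒' b) → MI□⊢ (b ⇒' c) → MI□⊢ (a ⇒' c)
⇒-trans f g = closed (lam (app (thm g) (app (thm f) #0)))

⇒-mono : ∀ {f a b} → MI□⊢ (a ⇒' b) → MI□⊢ ((f ⇒' a) ⇒' (f ⇒' b))
⇒-mono p = closed (lam (lam (app (thm p) (app #1 #0))))

⇒-swap : ∀ {a b c} → MI□⊢ ((a ⇒' b ⇒' c) ⇒' (b ⇒' a ⇒' c))
⇒-swap = closed (lam (lam (lam (app (app #2 #0) #1))))

⇒-contract : ∀ {a b} → MI□⊢ ((a ⇒' a ⇒' b) ⇒' (a ⇒' b))
⇒-contract = closed (lam (lam (app (app #1 #0) #0)))

⇒-∧ : ∀ {f a b} → MI□⊢ (((f ⇒' a) ∧' (f ⇒' b)) ⇒' (f ⇒' a ∧' b))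
⇒-∧ = closed (lam (lam (∧-intro (app (∧-elimˡ #1) #0) (app (∧-elimʳ #1) #0))))

⇔-to : ∀ {a b} → MI□⊢ (a ⇔' b) → MI□⊢ (a ⇒' b)
⇔-to p = MP p (H3 _ _)

⇔-from : ∀ {a b} → MI□⊢ (a ⇔' b) → MI□⊢ (b ⇒' a)
⇔-from p = MP p (H4 _ _)

□-mono : ∀ {a b} → MI□⊢ (a ⇒' b) → MI□⊢ (□' a ⇒' □' b)
□-mono {a} {b} f = ⇒-trans (⇔-to □a⇔□[a∧b]) (closed (lam (∧-elimʳ (app (thm (⇔-to (B∧ a b))) #0))))
  where
  □a⇔□[a∧b] : MI□⊢ (□' a ⇔' □' (a ∧' b))
  □a⇔□[a∧b] = RE□ (closed (∧-intro (lam (∧-intro #0 (app (thm f) #0))) (lam (∧-elimˡ #0))))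

□-nec : ∀ {a} → MI□⊢ a → MI□⊢ (□' a)
□-nec {a} p = MP (MP H6 (⇔-from B⊤)) (⇔-to □⊤⇔□a)
  where
  □⊤⇔□a : MI□⊢ (□' ⊤' ⇔' □' a)
  □⊤⇔□a = RE□ (closed (∧-intro (lam (thm p)) (lam (thm H6))))

□-∧ : ∀ {a b} → MI□⊢ ((□' a ∧' □' b) ⇒' □' (a ∧' b))
□-∧ {a} {b} = ⇔-from (B∧ a b)

Ctx : List Form → Set
Ctx L = Vec Bool (length L)

infix 4 _⊑_

_⊑_ : ∀ {n} → Vec Bool n → Vec Bool n → Set
_⊑_ = Pointwise Bool._≤_

premises : (L : List Form) → Ctx L → Form → Form
premises []      []          χ = χ
premises (a ∷ L) (true  ∷ Γ) χ = a ⇒' premises L Γ χ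
premises (a ∷ L) (false ∷ Γ) χ = premises L Γ χ

∅ : ∀ L → Ctx L
∅ L = replicate (length L) false

premises-∅ : ∀ L χ → premises L (∅ L) χ ≡ χ
premises-∅ []      χ = refl
premises-∅ (a ∷ L) χ = premises-∅ L χ

premises-mono : ∀ L Γ {a b} → MI□⊢ (a ⇒' b) → MI□⊢ (premises L Γ a ⇒' premises L Γ b)
premises-mono []      []          p = p
premises-mono (f ∷ L) (true  ∷ Γ) p = ⇒-mono (premises-mono L Γ p)
premises-mono (f ∷ L) (false ∷ Γ) p = premises-mono L Γ p

premises-∧ : ∀ L Γ {a b} → MI□⊢ ((premises L Γ a ∧' premises L Γ b) ⇒' premises L Γ (a ∧' b))
premises-∧ []      []          = ⇒-refl
premises-∧ (f ∷ L) (true  ∷ Γ) = ⇒-trans ⇒-∧ (⇒-mono (premises-∧ L Γ))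
premises-∧ (f ∷ L) (false ∷ Γ) = premises-∧ L Γ

premises-nec : ∀ L Γ {a} → MI□⊢ a → MI□⊢ (premises L Γ a)
premises-nec []      []          p = p
premises-nec (f ∷ L) (true  ∷ Γ) p = MP (premises-nec L Γ p) (H1 _ _)
premises-nec (f ∷ L) (false ∷ Γ) p = premises-nec L Γ p

premises-⊑ : ∀ L {Γ Δ χ} → Γ ⊑ Δ → MI□⊢ (premises L Γ χ ⇒' premises L Δ χ)
premises-⊑ []      []                       = ⇒-refl
premises-⊑ (f ∷ L) {true  ∷ _} (Bool.b≤b ∷ p) = ⇒-mono (premises-⊑ L p)
premises-⊑ (f ∷ L) {false ∷ _} (Bool.b≤b ∷ p) = premises-⊑ L p
premises-⊑ (f ∷ L) (Bool.f≤t ∷ p)            = ⇒-trans (premises-⊑ L p) (H1 _ _)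

premises-⇒⁻ : ∀ L Γ {a χ} → MI□⊢ (premises L Γ (a ⇒' χ) ⇒' (a ⇒' premises L Γ χ))
premises-⇒⁻ []      []          = ⇒-refl
premises-⇒⁻ (f ∷ L) (true  ∷ Γ) = ⇒-trans (⇒-mono (premises-⇒⁻ L Γ)) ⇒-swap
premises-⇒⁻ (f ∷ L) (false ∷ Γ) = premises-⇒⁻ L Γ

premises-⇒⁺ : ∀ L Γ {a χ} → MI□⊢ ((a ⇒' premises L Γ χ) ⇒' premises L Γ (a ⇒' χ))
premises-⇒⁺ []      []          = ⇒-refl
premises-⇒⁺ (f ∷ L) (true  ∷ Γ) = ⇒-trans ⇒-swap (⇒-mono (premises-⇒⁺ L Γ))
premises-⇒⁺ (f ∷ L) (false ∷ Γ) = premises-⇒⁺ L Γ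

assume : ∀ {a L} → a ∈ L → Ctx L → Ctx L
assume (here _)  (_ ∷ Γ) = true ∷ Γ
assume (there m) (b ∷ Γ) = b ∷ assume m Γ

⊑-assume : ∀ {a L} (m : a ∈ L) Γ → Γ ⊑ assume m Γ
⊑-assume (here _)  (b ∷ Γ) = Boolₚ.≤-maximum b ∷ Pointwise.refl Boolₚ.≤-refl
⊑-assume (there m) (b ∷ Γ) = Boolₚ.≤-refl ∷ ⊑-assume m Γ

premises-assume⁻ : ∀ {a L} (m : a ∈ L) Γ {χ} →
                   MI□⊢ (premises L (assume m Γ) χ ⇒' premises L Γ (a ⇒' χ))
premises-assume⁻ {L = _ ∷ L} (here refl) (true  ∷ Γ) = ⇒-mono (premises-mono L Γ (H1 _ _))
premises-assume⁻ {L = _ ∷ L} (here refl) (false ∷ Γ) = premises-⇒⁺ L Γ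
premises-assume⁻ (there m) (true  ∷ Γ) = ⇒-mono (premises-assume⁻ m Γ)
premises-assume⁻ (there m) (false ∷ Γ) = premises-assume⁻ m Γ

premises-assume⁺ : ∀ {a L} (m : a ∈ L) Γ {χ} →
                   MI□⊢ (premises L Γ (a ⇒' χ) ⇒' premises L (assume m Γ) χ)
premises-assume⁺ {L = _ ∷ L} (here refl) (true  ∷ Γ) = ⇒-trans (⇒-mono (premises-⇒⁻ L Γ)) ⇒-contract
premises-assume⁺ {L = _ ∷ L} (here refl) (false ∷ Γ) = premises-⇒⁻ L Γ
premises-assume⁺ (there m) (true  ∷ Γ) = ⇒-mono (premises-assume⁺ m Γ)
premises-assume⁺ (there m) (false ∷ Γ) = premises-assume⁺ m Γ

vecsOver : ∀ {a} {A : Set a} → List A → ∀ n → List (Vec A n)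
vecsOver xs zero    = [] ∷ []
vecsOver xs (suc n) = cartesianProductWith _∷_ xs (vecsOver xs n)

∈-vecsOver : ∀ {a} {A : Set a} {xs : List A} → (∀ x → x ∈ xs) → ∀ {n} (v : Vec A n) → v ∈ vecsOver xs n
∈-vecsOver all-∈ []      = here refl
∈-vecsOver all-∈ (x ∷ v) = ∈-cartesianProductWith⁺ _∷_ (all-∈ x) (∈-vecsOver all-∈ v)

sublists : ∀ {a} {A : Set a} → List A → List (List A)
sublists []       = [] ∷ []
sublists (x ∷ xs) = map (x ∷_) (sublists xs) ++ sublists xs

filter-∈-sublists : ∀ {a p} {A : Set a} {P : Pred A p} (P? : Decidable P) xs → filter P? xs ∈ sublists xs
filter-∈-sublists P? []       = here refl
filter-∈-sublists P? (x ∷ xs) with does (P? x)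
... | true  = ∈-++⁺ˡ (∈-map⁺ (x ∷_) (filter-∈-sublists P? xs))
... | false = ∈-++⁺ʳ (map (x ∷_) (sublists xs)) (filter-∈-sublists P? xs)

Any-zipWith : ∀ {a p q r} {A : Set a} {P : Pred A p} {Q : Pred A q} {R : Pred A r} →
              (∀ {x} → P x → Q x → R x) → ∀ {xs} → All P xs → Any Q xs → Any R xs
Any-zipWith f (px ∷ _)  (here qx) = here (f px qx)
Any-zipWith f (_ ∷ pxs) (there i) = there (Any-zipWith f pxs i)

module FrameFilters {ℓ} (F : BoxFrame ℓ) where
  open BoxFrame F renaming (refl to ≤-refl; trans to ≤-trans)
  open import Relation.Binary.Lattice.Properties.MeetSemilattice meetSemilattice using (∧-comm; ∧-idempotent)

  ⊤-∈ : ∀ {a} → IsFilter iframe a → a ⊤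
  ⊤-∈ fa = IsFilter.upclosed fa (proj₂ (IsFilter.nonempty fa)) (maximum _)

  ⇨-mp : ∀ x y → (x ⇨ y) ∧ x ≤ y
  ⇨-mp x y = proj₂ (exponential (x ⇨ y) x y) ≤-refl

  -- An element above x ∧ x' is the meet of z = x' ⇨ y ≥ x and z ⇨ y ≥ x', both above y.
  ≥∧-split : ∀ {x x' y} → x ∧ x' ≤ y →
             Σ[ z ∈ Carrier ] Σ[ u ∈ Carrier ] (x ≤ z × x' ≤ u × y ≤ z × y ≤ u × z ∧ u ≤ y)
  ≥∧-split {x} {x'} {y} x∧x'≤y =
      x' ⇨ y , (x' ⇨ y) ⇨ y
    , proj₁ (exponential x x' y) x∧x'≤y
    , proj₁ (exponential x' (x' ⇨ y) y) (≤-trans (reflexive (∧-comm x' (x' ⇨ y))) (⇨-mp x' y))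
    , proj₁ (exponential y x' y) (x∧y≤x y x')
    , proj₁ (exponential y (x' ⇨ y) y) (x∧y≤x y _)
    , ≤-trans (reflexive (∧-comm _ _)) (⇨-mp (x' ⇨ y) y)

  R-antitone : ∀ {x x' y} → x ≤ x' → R x' y → R x y
  R-antitone {x} {x'} {y} x≤x' r =
    R-resp (antisym (x∧y≤x x x') (∧-greatest ≤-refl x≤x')) (B2 (B3 (B1c x) r) (x∧y≤y ⊤ y))

  ∩-isFilter : ∀ {a b} → IsFilter iframe a → IsFilter iframe b → IsFilter iframe (λ x → a x × b x)
  ∩-isFilter fa fb = record
    { nonempty = ⊤ , ⊤-∈ fa , ⊤-∈ fb
    ; upclosed = λ (p , q) l → IsFilter.upclosed fa p l , IsFilter.upclosed fb q l
    ; meet     = λ (p , q) (p' , q') → IsFilter.meet fa p p' , IsFilter.meet fb q q'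
    }

  ⇛-isFilter : ∀ {a b} → IsFilter iframe a → IsFilter iframe b →
               IsFilter iframe (λ x → ∀ y → x ≤ y → a y → b y)
  ⇛-isFilter {a} {b} fa fb = record
    { nonempty = ⊤ , λ y ⊤≤y _ → IsFilter.upclosed fb (⊤-∈ fb) ⊤≤y
    ; upclosed = λ h x≤x' y x'≤y → h y (≤-trans x≤x' x'≤y)
    ; meet     = meet
    }
    where
    meet : ∀ {x x'} → (∀ y → x ≤ y → a y → b y) → (∀ y → x' ≤ y → a y → b y) →
           ∀ y → x ∧ x' ≤ y → a y → b y
    meet hx hx' y x∧x'≤y ay with ≥∧-split x∧x'≤y
    ... | z , u , x≤z , x'≤u , y≤z , y≤u , z∧u≤y =
      IsFilter.upclosed fb
        (IsFilter.meet fb (hx z x≤z (IsFilter.upclosed fa ay y≤z)) (hx' u x'≤u (IsFilter.upclosed fa ay y≤u)))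
        z∧u≤y

  □-isFilter : ∀ {a} → IsFilter iframe a → IsFilter iframe (λ x → ∀ {y} → R x y → a y)
  □-isFilter {a} fa = record
    { nonempty = ⊤ , λ {y} r → IsFilter.upclosed fa (⊤-∈ fa) (reflexive (Eq.sym (B1a y r)))
    ; upclosed = λ h x≤x' r → h (R-antitone x≤x' r)
    ; meet     = λ h h' r → let y , y' , ry , ry' , y∧y'≈z = B4 r in
                 IsFilter.upclosed fa (IsFilter.meet fa (h ry) (h' ry')) (reflexive y∧y'≈z)
    }

  R-isFilter : ∀ x → IsFilter iframe (R x)
  R-isFilter x = record
    { nonempty = ⊤ , B1c x
    ; upclosed = B2
    ; meet     = λ r r' → R-resp (∧-idempotent x) (B3 r r')
    }

  ↑-isFilter : ∀ x → IsFilter iframe (x ≤_)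
  ↑-isFilter x = record { nonempty = ⊤ , maximum x ; upclosed = ≤-trans ; meet = ∧-greatest }

finiteSubcover : ∀ {a ℓ} {X : Set a} (S T : Pred (Pred X ℓ) ℓ) →
                 (∀ x → (Σ[ s ∈ Pred X ℓ ] (S s × s x)) ⊎ (Σ[ t ∈ Pred X ℓ ] (T t × ¬ t x))) →
                 (xs : List X) →
                 Σ[ ss ∈ List (Pred X ℓ) ] Σ[ ts ∈ List (Pred X ℓ) ]
                   (All S ss × All T ts × (∀ {x} → x ∈ xs → Any (λ s → s x) ss ⊎ Any (λ t → ¬ t x) ts))
finiteSubcover S T cover [] = [] , [] , [] , [] , λ ()
finiteSubcover S T cover (x ∷ xs) with cover x | finiteSubcover S T cover xs
... | inj₁ (s , Ss , sx) | ss , ts , Sss , Tts , covers =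
  s ∷ ss , ts , Ss ∷ Sss , Tts , λ { (here refl) → inj₁ (here sx) ; (there m) → Sum.map there id (covers m) }
... | inj₂ (t , Tt , ¬tx) | ss , ts , Sss , Tts , covers =
  ss , t ∷ ts , Sss , Tt ∷ Tts , λ { (here refl) → inj₂ (here ¬tx) ; (there m) → Sum.map id there (covers m) }

-- Compactness: filters are unions of ≈-classes, so a subcover of the finitely many
-- representatives covers everything.
finite⇒descriptive : ∀ {ℓ} (F : BoxFrame ℓ) (enum : List (BoxFrame.Carrier F)) →
                     (∀ x → Any (BoxFrame._≈_ F x) enum) → DescFrame ℓ
finite⇒descriptive F enum enum-complete = record
  { frame          = F
  ; A              = IsFilter iframe
  ; A-filters      = λ _ fa → fa
  ; A-∩            = λ _ _ → ∩-isFilter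
  ; A-⇒            = λ _ _ → ⇛-isFilter
  ; A-□            = λ _ fa → □-isFilter fa
  ; differentiated = λ x y x≰y → (x ≤_) , ↑-isFilter x , ≤-refl , x≰y
  ; compact        = compact
  ; R⊆⋂            = λ _ _ r _ _ R[x]⊆a → R[x]⊆a r
  ; ⋂⊆R            = λ x _ y∈⋂ → y∈⋂ (R x) (R-isFilter x) id
  }
  where
  open BoxFrame F renaming (refl to ≤-refl)
  open FrameFilters F

  compact : ∀ (S T : Pred (Pred Carrier _) _) → (∀ {a} → S a → IsFilter iframe a) → (∀ {a} → T a → IsFilter iframe a) →
            (∀ x → (Σ[ s ∈ Pred Carrier _ ] (S s × s x)) ⊎ (Σ[ t ∈ Pred Carrier _ ] (T t × ¬ t x))) →
            Σ[ ss ∈ List (Pred Carrier _) ] Σ[ ts ∈ List (Pred Carrier _) ]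
              (All S ss × All T ts × (∀ x → Any (λ s → s x) ss ⊎ Any (λ t → ¬ t x) ts))
  compact S T S⊆A T⊆A cover =
    let ss , ts , Sss , Tts , covers = finiteSubcover S T cover enum in
    ss , ts , Sss , Tts , λ x →
      let e , e∈enum , x≈e = find (enum-complete x) in
      Sum.map (Any-zipWith (λ Ss se → IsFilter.upclosed (S⊆A Ss) se (reflexive (Eq.sym x≈e))) Sss)
              (Any-zipWith (λ Tt ¬te tx → ¬te (IsFilter.upclosed (T⊆A Tt) tx (reflexive x≈e))) Tts)
              (covers e∈enum)

module Worlds (L : List Form) where

  -- A world is a modal context  Γ₀ ⇒ □ (Γ₁ ⇒ □ (… ⇒ □ (Γₖ ⇒ [ ])))  with k ≤ d,
  -- each Γᵢ a set of premises from L; room counts the boxes d − k still available.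
  data World : ℕ → Set where
    leaf : ∀ {d} → Ctx L → World d
    node : ∀ {d} → Ctx L → World d → World (suc d)

  plug : ∀ {d} → World d → Form → Form
  plug (leaf Γ)   χ = premises L Γ χ
  plug (node Γ u) χ = premises L Γ (□' (plug u χ))

  room : ∀ {d} → World d → ℕ
  room (leaf {d} _) = d
  room (node _ u)   = room u

  plug-mono : ∀ {d} (w : World d) {a b} → MI□⊢ (a ⇒' b) → MI□⊢ (plug w a ⇒' plug w b)
  plug-mono (leaf Γ)   p = premises-mono L Γ p
  plug-mono (node Γ u) p = premises-mono L Γ (□-mono (plug-mono u p))

  plug-∧ : ∀ {d} (w : World d) {a b} → MI□⊢ ((plug w a ∧' plug w b) ⇒' plug w (a ∧' b))
  plug-∧ (leaf Γ)   = premises-∧ L Γ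
  plug-∧ (node Γ u) = ⇒-trans (premises-∧ L Γ) (premises-mono L Γ (⇒-trans □-∧ (□-mono (plug-∧ u))))

  plug-nec : ∀ {d} (w : World d) {a} → MI□⊢ a → MI□⊢ (plug w a)
  plug-nec (leaf Γ)   p = premises-nec L Γ p
  plug-nec (node Γ u) p = premises-nec L Γ (□-nec (plug-nec u p))

  plug-MP : ∀ {d} (w : World d) {a b} → MI□⊢ (plug w a) → MI□⊢ (plug w (a ⇒' b)) → MI□⊢ (plug w b)
  plug-MP w x f = MP (MP (closed (∧-intro (thm x) (thm f))) (plug-∧ w))
                     (plug-mono w (closed (lam (app (∧-elimʳ #0) (∧-elimˡ #0)))))

  -- On a world without room, deepen is the identity.
  deepen : ∀ {d} → World d → World d
  deepen (leaf {zero} Γ)  = leaf Γ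
  deepen (leaf {suc d} Γ) = node Γ (leaf (∅ L))
  deepen (node Γ u)       = node Γ (deepen u)

  room-deepen : ∀ {d n} (w : World d) → suc n ℕ.≤ room w → n ℕ.≤ room (deepen w)
  room-deepen (leaf {suc d} Γ) (s≤s n≤d) = n≤d
  room-deepen (node Γ u)       n<room    = room-deepen u n<room

  plug-deepen : ∀ {d} (w : World d) χ → 1 ℕ.≤ room w → plug (deepen w) χ ≡ plug w (□' χ)
  plug-deepen (leaf {suc d} Γ) χ _ = cong (λ ψ → premises L Γ (□' ψ)) (premises-∅ L χ)
  plug-deepen (node Γ u)       χ r = cong (λ ψ → premises L Γ (□' ψ)) (plug-deepen u χ r)

  assumeʷ : ∀ {a d} → a ∈ L → World d → World d
  assumeʷ m (leaf Γ)   = leaf (assume m Γ)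
  assumeʷ m (node Γ u) = node Γ (assumeʷ m u)

  room-assume : ∀ {a d} (m : a ∈ L) (w : World d) → room (assumeʷ m w) ≡ room w
  room-assume m (leaf Γ)   = refl
  room-assume m (node Γ u) = room-assume m u

  plug-assume⁻ : ∀ {a d} (m : a ∈ L) (w : World d) {χ} →
                 MI□⊢ (plug (assumeʷ m w) χ ⇒' plug w (a ⇒' χ))
  plug-assume⁻ m (leaf Γ)   = premises-assume⁻ m Γ
  plug-assume⁻ m (node Γ u) = premises-mono L Γ (□-mono (plug-assume⁻ m u))

  plug-assume⁺ : ∀ {a d} (m : a ∈ L) (w : World d) {χ} →
                 MI□⊢ (plug w (a ⇒' χ) ⇒' plug (assumeʷ m w) χ)
  plug-assume⁺ m (leaf Γ)   = premises-assume⁺ m Γ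
  plug-assume⁺ m (node Γ u) = premises-mono L Γ (□-mono (plug-assume⁺ m u))

  infix 4 _≤ʷ_ _≤ʷ?_

  data _≤ʷ_ : ∀ {d} → World d → World d → Set where
    leaf : ∀ {d Γ Δ} → Γ ⊑ Δ → leaf {d} Γ ≤ʷ leaf Δ
    node : ∀ {d Γ Δ} {u v : World d} → Γ ⊑ Δ → u ≤ʷ v → node Γ u ≤ʷ node Δ v

  ≤ʷ-refl : ∀ {d} {w : World d} → w ≤ʷ w
  ≤ʷ-refl {w = leaf Γ}   = leaf (Pointwise.refl Boolₚ.≤-refl)
  ≤ʷ-refl {w = node Γ u} = node (Pointwise.refl Boolₚ.≤-refl) ≤ʷ-refl

  ≤ʷ-trans : ∀ {d} {u v w : World d} → u ≤ʷ v → v ≤ʷ w → u ≤ʷ w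
  ≤ʷ-trans (leaf p)   (leaf q)   = leaf (Pointwise.trans Boolₚ.≤-trans p q)
  ≤ʷ-trans (node p r) (node q s) = node (Pointwise.trans Boolₚ.≤-trans p q) (≤ʷ-trans r s)

  _≤ʷ?_ : ∀ {d} (u v : World d) → Dec (u ≤ʷ v)
  leaf Γ   ≤ʷ? leaf Δ   = map′ leaf (λ { (leaf p) → p }) (Pointwise.decidable Boolₚ._≤?_ Γ Δ)
  node Γ u ≤ʷ? node Δ v = map′ (uncurry node) (λ { (node p q) → p , q })
                                (Pointwise.decidable Boolₚ._≤?_ Γ Δ ×-dec u ≤ʷ? v)
  leaf _   ≤ʷ? node _ _ = no λ ()
  node _ _ ≤ʷ? leaf _   = no λ ()

  ≤ʷ-sound : ∀ {d} {u v : World d} {χ} → u ≤ʷ v → MI□⊢ (plug u χ ⇒' plug v χ)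
  ≤ʷ-sound (leaf p)                 = premises-⊑ L p
  ≤ʷ-sound {u = node Γ _} (node p q) = ⇒-trans (premises-mono L Γ (□-mono (≤ʷ-sound q))) (premises-⊑ L p)

  ≤ʷ-room : ∀ {d} {u v : World d} → u ≤ʷ v → room u ≡ room v
  ≤ʷ-room (leaf _)   = refl
  ≤ʷ-room (node _ q) = ≤ʷ-room q

  ≤ʷ-deepen : ∀ {d} {u v : World d} → u ≤ʷ v → deepen u ≤ʷ deepen v
  ≤ʷ-deepen {u = leaf {zero} _}  (leaf p)   = leaf p
  ≤ʷ-deepen {u = leaf {suc d} _} (leaf p)   = node p ≤ʷ-refl
  ≤ʷ-deepen                      (node p q) = node p (≤ʷ-deepen q)

  ≤ʷ-assume : ∀ {a d} (m : a ∈ L) (w : World d) → w ≤ʷ assumeʷ m w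
  ≤ʷ-assume m (leaf Γ)   = leaf (⊑-assume m Γ)
  ≤ʷ-assume m (node Γ u) = node (Pointwise.refl Boolₚ.≤-refl) (≤ʷ-assume m u)

  contexts : List (Ctx L)
  contexts = vecsOver (true ∷ false ∷ []) (length L)

  ∈-contexts : ∀ Γ → Γ ∈ contexts
  ∈-contexts = ∈-vecsOver λ { true → here refl ; false → there (here refl) }

  worlds : ∀ d → List (World d)
  worlds zero    = map leaf contexts
  worlds (suc d) = map leaf contexts ++ cartesianProductWith node contexts (worlds d)

  ∈-worlds : ∀ {d} (w : World d) → w ∈ worlds d
  ∈-worlds {zero}  (leaf Γ)   = ∈-map⁺ leaf (∈-contexts Γ)
  ∈-worlds {suc d} (leaf Γ)   = ∈-++⁺ˡ (∈-map⁺ leaf (∈-contexts Γ))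
  ∈-worlds {suc d} (node Γ u) = ∈-++⁺ʳ (map leaf contexts) (∈-cartesianProductWith⁺ node (∈-contexts Γ) (∈-worlds u))

module Points (L : List Form) (D : ℕ) where
  open Worlds L

  Point : Set
  Point = List (World D)

  Covers : Point → World D → Set
  Covers P q = Any (_≤ʷ q) P

  covers? : ∀ P q → Dec (Covers P q)
  covers? P q = any? (_≤ʷ? q) P

  infix 4 _≼_ _≈_

  _≼_ : Point → Point → Set
  P ≼ Q = ∀ {q} → q ∈ Q → Covers P q

  _≈_ : Point → Point → Set
  P ≈ Q = P ≼ Q × Q ≼ P

  ⊇⇒≼ : ∀ {P Q} → Q ⊆ P → P ≼ Q
  ⊇⇒≼ Q⊆P q∈Q = lose (Q⊆P q∈Q) ≤ʷ-refl

  ≼-refl : ∀ {P} → P ≼ P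
  ≼-refl = ⊇⇒≼ id

  ≼-trans : ∀ {P Q R} → P ≼ Q → Q ≼ R → P ≼ R
  ≼-trans P≼Q Q≼R r∈R =
    let q , q∈Q , q≤r = find (Q≼R r∈R) in Any.map (λ p≤q → ≤ʷ-trans p≤q q≤r) (P≼Q q∈Q)

  ++-≼ˡ : ∀ P Q → P ++ Q ≼ P
  ++-≼ˡ P Q = ⊇⇒≼ ∈-++⁺ˡ

  ++-≼ʳ : ∀ P Q → P ++ Q ≼ Q
  ++-≼ʳ P Q = ⊇⇒≼ (∈-++⁺ʳ P)

  ≼-++ : ∀ {Z P Q} → Z ≼ P → Z ≼ Q → Z ≼ P ++ Q
  ≼-++ {P = P} Z≼P Z≼Q q∈P++Q = Sum.[ Z≼P , Z≼Q ] (∈-++⁻ P q∈P++Q)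

  ++-mono : ∀ {P Q P' Q'} → P ≼ Q → P' ≼ Q' → P ++ P' ≼ Q ++ Q'
  ++-mono {P} {Q} P≼Q P'≼Q' = ≼-++ (≼-trans (++-≼ˡ P _) P≼Q) (≼-trans (++-≼ʳ P _) P'≼Q')

  infixr 5 _⇨_

  _⇨_ : Point → Point → Point
  P ⇨ Q = filter (λ q → ¬? (covers? P q)) Q

  ⇨-exponential : ∀ W P Q → (W ++ P ≼ Q → W ≼ P ⇨ Q) × (W ≼ P ⇨ Q → W ++ P ≼ Q)
  ⇨-exponential W P Q = curry , uncurry′
    where
    curry : W ++ P ≼ Q → W ≼ P ⇨ Q
    curry W++P≼Q q∈P⇨Q with ∈-filter⁻ (λ q → ¬? (covers? P q)) {xs = Q} q∈P⇨Q
    ... | q∈Q , ¬PcovQ = Sum.[ id , ⊥-elim ∘ ¬PcovQ ] (Anyₚ.++⁻ W (W++P≼Q q∈Q))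
    uncurry′ : W ≼ P ⇨ Q → W ++ P ≼ Q
    uncurry′ W≼P⇨Q {q} q∈Q with covers? P q
    ... | yes PcovQ  = Anyₚ.++⁺ʳ W PcovQ
    ... | no ¬PcovQ  = Anyₚ.++⁺ˡ (W≼P⇨Q (∈-filter⁺ (λ q → ¬? (covers? P q)) q∈Q ¬PcovQ))

  covered : Point → Point → Point
  covered P Z = filter (covers? P) Z

  covered-⊆ : ∀ P Z → covered P Z ⊆ Z
  covered-⊆ P Z = proj₁ ∘ ∈-filter⁻ (covers? P) {xs = Z}

  ≼-covered : ∀ P Z → P ≼ covered P Z
  ≼-covered P Z = proj₂ ∘ ∈-filter⁻ (covers? P) {xs = Z}

  ∈-covered : ∀ {P Z q} → q ∈ Z → Covers P q → q ∈ covered P Z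
  ∈-covered = ∈-filter⁺ (covers? _)

  ≈-covered-worlds : ∀ P → P ≈ covered P (worlds D)
  ≈-covered-worlds P = ≼-covered P (worlds D) , ⊇⇒≼ λ {q} q∈P → ∈-covered (∈-worlds q) (lose q∈P ≤ʷ-refl)

  ≼-++-split : ∀ {P P' Z} → P ++ P' ≼ Z → Σ[ Y ∈ Point ] Σ[ Y' ∈ Point ] (P ≼ Y × P' ≼ Y' × Y ++ Y' ≈ Z)
  ≼-++-split {P} {P'} {Z} P++P'≼Z =
    Y , Y' , ≼-covered P Z , ≼-covered P' Z , ⊇⇒≼ Z⊆Y++Y' , ⊇⇒≼ Y++Y'⊆Z
    where
    Y  = covered P Z
    Y' = covered P' Z
    Y++Y'⊆Z : Y ++ Y' ⊆ Z
    Y++Y'⊆Z = Sum.[ covered-⊆ P Z , covered-⊆ P' Z ] ∘ ∈-++⁻ Y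
    Z⊆Y++Y' : Z ⊆ Y ++ Y'
    Z⊆Y++Y' q∈Z = Sum.[ ∈-++⁺ˡ ∘ ∈-covered q∈Z , ∈-++⁺ʳ Y ∘ ∈-covered q∈Z ] (Anyₚ.++⁻ P (P++P'≼Z q∈Z))

  □ₚ : Point → Point
  □ₚ = map deepen

  □ₚ-mono : ∀ {P Q} → P ≼ Q → □ₚ P ≼ □ₚ Q
  □ₚ-mono P≼Q q'∈□Q with ∈-map⁻ deepen q'∈□Q
  ... | q , q∈Q , refl = Anyₚ.map⁺ (Any.map ≤ʷ-deepen (P≼Q q∈Q))

  R : Point → Point → Set
  R P Q = □ₚ P ≼ Q

  bms : BoundedMeetSemilattice 0ℓ 0ℓ 0ℓ
  bms = record
    { Carrier = Point ; _≈_ = _≈_ ; _≤_ = _≼_ ; _∧_ = _++_ ; ⊤ = []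
    ; isBoundedMeetSemilattice = record
      { isMeetSemilattice = record
        { isPartialOrder = record
          { isPreorder = record
            { isEquivalence = record
              { refl  = ≼-refl , ≼-refl
              ; sym   = λ (P≼Q , Q≼P) → Q≼P , P≼Q
              ; trans = λ (P≼Q , Q≼P) (Q≼R , R≼Q) → ≼-trans P≼Q Q≼R , ≼-trans R≼Q Q≼P
              }
            ; reflexive = proj₁
            ; trans     = ≼-trans
            }
          ; antisym = _,_
          }
        ; infimum = λ P Q → ++-≼ˡ P Q , ++-≼ʳ P Q , λ _ → ≼-++
        }
      ; maximum = λ _ ()
      }
    }

  frame : BoxFrame 0ℓ
  frame = record
    { iframe = record { bms = bms ; _⇨_ = _⇨_ ; exponential = ⇨-exponential }
    ; R      = R
    ; R-resp = λ (_ , P'≼P) → ≼-trans (□ₚ-mono P'≼P)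
    ; B1a    = λ _ []≼P → (λ ()) , []≼P
    ; B1b    = λ _ → proj₂
    ; B1c    = λ _ ()
    ; B2     = ≼-trans
    ; B3     = λ {P} {P'} RPQ RP'Q' → subst (_≼ _) (sym (map-++ deepen P P')) (++-mono RPQ RP'Q')
    ; B4     = λ {P} {P'} RP++P'Z → ≼-++-split (subst (_≼ _) (map-++ deepen P P') RP++P'Z)
    }

  descFrame : DescFrame 0ℓ
  descFrame = finite⇒descriptive frame (sublists (worlds D))
    λ P → lose (filter-∈-sublists (covers? P) (worlds D)) (≈-covered-worlds P)

antecedents : Form → List Form
antecedents ⊤'       = []
antecedents (var _)  = []
antecedents (a ∧' b) = antecedents a ++ antecedents b
antecedents (a ⇒' b) = a ∷ antecedents a ++ antecedents b
antecedents (□' a)   = antecedents a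

depth : Form → ℕ
depth ⊤'       = 0
depth (var _)  = 0
depth (a ∧' b) = depth a ⊔ depth b
depth (a ⇒' b) = depth a ⊔ depth b
depth (□' a)   = suc (depth a)

module Canonical (L : List Form) (D : ℕ) where
  open Worlds L
  open Points L D

  Proves : Point → Form → Set
  Proves P χ = All (λ w → MI□⊢ (plug w χ)) P

  Proves-≼ : ∀ {P Q χ} → P ≼ Q → Proves P χ → Proves Q χ
  Proves-≼ P≼Q ⊢P = All.tabulate λ q∈Q →
    let p , p∈P , p≤q = find (P≼Q q∈Q) in MP (All.lookup ⊢P p∈P) (≤ʷ-sound p≤q)

  Proves-isFilter : ∀ χ → IsFilter (BoxFrame.iframe frame) (λ P → Proves P χ)
  Proves-isFilter χ = record
    { nonempty = [] , []
    ; upclosed = λ ⊢P P≼Q → Proves-≼ P≼Q ⊢P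
    ; meet     = Allₚ.++⁺
    }

  model : DescModel 0ℓ
  model = record
    { dframe = descFrame
    ; V      = λ p P → Proves P (var p)
    ; V-A    = λ p → Proves-isFilter (var p)
    }

  Sat : Point → Form → Set
  Sat P χ = Defs._,_⊩_ (DescModel.model model) P χ

  Proves-∧ : ∀ {P a b} → Proves P (a ∧' b) ⇔ (Proves P a × Proves P b)
  Proves-∧ {a = a} {b} = mk⇔
    (λ ⊢P → All.map (λ {w} ⊢ab → MP ⊢ab (plug-mono w (H3 a b))) ⊢P
          , All.map (λ {w} ⊢ab → MP ⊢ab (plug-mono w (H4 a b))) ⊢P)
    (All.zipWith λ {w} (⊢a , ⊢b) → MP (closed (∧-intro (thm ⊢a) (thm ⊢b))) (plug-∧ w))

  Roomy : ℕ → Point → Set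
  Roomy n P = All (λ w → n ℕ.≤ room w) P

  Roomy-≤ : ∀ {m n P} → m ℕ.≤ n → Roomy n P → Roomy m P
  Roomy-≤ m≤n = All.map (ℕₚ.≤-trans m≤n)

  Roomy-≼ : ∀ {n P Q} → P ≼ Q → Roomy n P → Roomy n Q
  Roomy-≼ {n} P≼Q roomy = All.tabulate λ q∈Q →
    let p , p∈P , p≤q = find (P≼Q q∈Q) in subst (n ℕ.≤_) (≤ʷ-room p≤q) (All.lookup roomy p∈P)

  Roomy-□ₚ : ∀ {n P} → Roomy (suc n) P → Roomy n (□ₚ P)
  Roomy-□ₚ = Allₚ.map⁺ ∘ All.map (λ {w} → room-deepen w)

  Proves-□ₚ : ∀ {P a} → Roomy 1 P → Proves (□ₚ P) a ⇔ Proves P (□' a)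
  Proves-□ₚ {a = a} roomy = mk⇔
    (λ ⊢□P → All.zipWith (λ {w} (r , ⊢w) → subst MI□⊢_ (plug-deepen w a r) ⊢w) (roomy , Allₚ.map⁻ ⊢□P))
    (λ ⊢P → Allₚ.map⁺ (All.zipWith (λ {w} (r , ⊢w) → subst MI□⊢_ (sym (plug-deepen w a r)) ⊢w) (roomy , ⊢P)))

  TruthAt : Form → Set
  TruthAt χ = ∀ {P} → Roomy (depth χ) P → Sat P χ ⇔ Proves P χ

  truth-∧ : ∀ {a b} → TruthAt a → TruthAt b → TruthAt (a ∧' b)
  truth-∧ {a} {b} IHa IHb roomy = mk⇔
    (λ (sa , sb) → from Proves-∧ (to (IHa ra) sa , to (IHb rb) sb))
    (λ ⊢P → from (IHa ra) (proj₁ (to Proves-∧ ⊢P)) , from (IHb rb) (proj₂ (to Proves-∧ ⊢P)))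
    where
    ra = Roomy-≤ (ℕₚ.m≤m⊔n (depth a) (depth b)) roomy
    rb = Roomy-≤ (ℕₚ.m≤n⊔m (depth a) (depth b)) roomy

  -- Sat P (a ⇒' b) is tested at the point generated by w with a assumed at its hole.
  truth-⇒ : ∀ {a b} → a ∈ L → TruthAt a → TruthAt b → TruthAt (a ⇒' b)
  truth-⇒ {a} {b} a∈L IHa IHb {P} roomy = mk⇔ fwd bwd
    where
    ra = Roomy-≤ (ℕₚ.m≤m⊔n (depth a) (depth b)) roomy
    rb = Roomy-≤ (ℕₚ.m≤n⊔m (depth a) (depth b)) roomy

    fwd : Sat P (a ⇒' b) → Proves P (a ⇒' b)
    fwd sat = All.tabulate λ {w} w∈P →
      let Q : Point
          Q = assumeʷ a∈L w ∷ []
          P≼Q : P ≼ Q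
          P≼Q = λ { (here refl) → lose w∈P (≤ʷ-assume a∈L w) }
          roomyQ : ∀ {n} → n ℕ.≤ room w → Roomy n Q
          roomyQ = λ {n} n≤room → subst (n ℕ.≤_) (sym (room-assume a∈L w)) n≤room ∷ []
          ⊢Qa : Proves Q a
          ⊢Qa = MP (plug-nec w ⇒-refl) (plug-assume⁺ a∈L w) ∷ []
          ⊢Qb : Proves Q b
          ⊢Qb = to (IHb (roomyQ (All.lookup rb w∈P))) (sat Q P≼Q (from (IHa (roomyQ (All.lookup ra w∈P))) ⊢Qa))
      in MP (All.head ⊢Qb) (plug-assume⁻ a∈L w)

    bwd : Proves P (a ⇒' b) → Sat P (a ⇒' b)
    bwd ⊢P Q P≼Q sa = from (IHb (Roomy-≼ P≼Q rb))
      (All.zipWith (λ {q} (⊢a , ⊢a⇒b) → plug-MP q ⊢a ⊢a⇒b) (to (IHa (Roomy-≼ P≼Q ra)) sa , Proves-≼ P≼Q ⊢P))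

  truth-□ : ∀ {a} → TruthAt a → TruthAt (□' a)
  truth-□ {a} IH {P} roomy = mk⇔ fwd bwd
    where
    roomy₁ = Roomy-≤ (s≤s z≤n) roomy
    roomy□ = Roomy-□ₚ roomy

    fwd : Sat P (□' a) → Proves P (□' a)
    fwd sat = to (Proves-□ₚ roomy₁) (to (IH roomy□) (sat (□ₚ P) ≼-refl))

    bwd : Proves P (□' a) → Sat P (□' a)
    bwd ⊢P Q RPQ = from (IH (Roomy-≼ RPQ roomy□)) (Proves-≼ RPQ (from (Proves-□ₚ roomy₁) ⊢P))

  truth : ∀ χ → antecedents χ ⊆ L → TruthAt χ
  truth ⊤'       _ {P} _ = mk⇔ (λ _ → All.universal (λ w → plug-nec w H6) P) _
  truth (var p)  _ _ = mk⇔ id id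
  truth (a ∧' b) h   = truth-∧ (truth a (h ∘ ∈-++⁺ˡ)) (truth b (h ∘ ∈-++⁺ʳ _))
  truth (a ⇒' b) h   = truth-⇒ (h (here refl)) (truth a (h ∘ there ∘ ∈-++⁺ˡ)) (truth b (h ∘ there ∘ ∈-++⁺ʳ _))
  truth (□' a)   h   = truth-□ (truth a h)

completeness : ∀ φ → (∀ P → Canonical.Sat (antecedents φ) (depth φ) P φ) → MI□⊢ φ
completeness φ valid = subst MI□⊢_ (premises-∅ L φ) (All.head (to (truth φ id roomy) (valid root)))
  where
  L = antecedents φ
  open Worlds L
  open Canonical L (depth φ)
  root : List (World (depth φ))
  root = leaf (∅ L) ∷ []
  roomy : Roomy (depth φ) root
  roomy = ℕₚ.≤-refl ∷ []

theorem5p9 : ∀ (φ : Form) →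
    (ValidBox φ → MI□⊢ φ) ×ω (ValidDesc φ → MI□⊢ φ)
theorem5p9 φ = (λ valid → completeness φ (valid (DescModel.model model))) ,ω (λ valid → completeness φ (valid model))
  where open Canonical (antecedents φ) (depth φ)
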